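{- Let $p_1=2, p_2=3, p_3=5,\dots$ denote the primes in increasing order. For $n\ge 1$ let $$T_n=\frac{\prod_{i=1}^{n-1}(p_i-1)}{\prod_{i=1}^{n}p_i}=\frac{1\cdot 2\cdot 4\cdots (p_{n-1}-1)}{2\cdot 3\cdot 5\cdots p_n},$$ (so $T_1=\tfrac12, T_2=\tfrac16, T_3=\tfrac{2}{30}, T_4=\tfrac{8}{210},\dots$; the empty product equals $1$), and let $S_n=\sum_{i=1}^n T_i$. Then $\lim_{n\to\infty} S_n = 1$.
   Context: Equivalently $T_n=\varphi(p_{n-1}\#)/p_n\#$, where $\varphi$ is Euler's totient function and $p_n\#=p_1p_2\cdots p_n$ is the primorial (with $p_0\#=1$). -}

module Defs where

open import Data.Nat using (ℕ; zero; suc; _*_; _∸_; NonZero)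
open import Data.Nat.Properties using (m*n≢0)
open import Data.Nat.Primality using (Prime; prime⇒nonZero)
open import Data.Integer using (+_)
open import Data.Rational using (ℚ; 0ℚ; _+_; _/_)

-- The prime sequence is indexed from 0 here: p 0 = p_1 = 2, p 1 = p_2 = 3, ...

numer : (ℕ → ℕ) → ℕ → ℕ
numer p zero    = 1
numer p (suc k) = numer p k * (p k ∸ 1)

denom : (ℕ → ℕ) → ℕ → ℕ
denom p zero    = p zero
denom p (suc k) = denom p k * p (suc k)

denom-nonZero : (p : ℕ → ℕ) → (∀ i → Prime (p i)) → ∀ k → NonZero (denom p k)
denom-nonZero p pr zero    = prime⇒nonZero (pr zero)
denom-nonZero p pr (suc k) =
  m*n≢0 (denom p k) (p (suc k)) {{denom-nonZero p pr k}} {{prime⇒nonZero (pr (suc k))}}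

-- T p pr k = T_{k+1} = numer p k / denom p k  (as a rational)
T : (p : ℕ → ℕ) → (∀ i → Prime (p i)) → ℕ → ℚ
T p pr k = _/_ (+ numer p k) (denom p k) {{denom-nonZero p pr k}}

-- S p pr n = S_n = Σ_{i=1}^{n} T_i = Σ_{k<n} T p pr k
S : (p : ℕ → ℕ) → (∀ i → Prime (p i)) → ℕ → ℚ
S p pr zero    = 0ℚ
S p pr (suc n) = S p pr n + T p pr n

-- With R k = ∏_{i<k} (1 - 1/p i), the density of the integers coprime to p 0 ⋯ p (k-1), the terms
-- are T_{k+1} = R k / p k = R k - R (k+1), so S n = 1 - R n and it remains to show R n → 0.
-- This is Euler's product argument made finite. Let F k x be the sum of 1/m over the m ≤ x whose
-- prime factors are all among p 0, …, p (k-1). Splitting off the multiples of p k gives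
-- F (k+1) x ≤ F k x + F (k+1) ⌊x/p k⌋ / p k, so R (k+1) F (k+1) x is at most a convex combination
-- of R k F k x and R (k+1) F (k+1) ⌊x/p k⌋, whence R k F k x ≤ 1 by induction on k and x. As the
-- primes are enumerated in order, every m < p k counts in F k, so R k · H (p k - 1) ≤ 1, while the
-- harmonic numbers H are unbounded.

module Submission where

open import Data.Nat as ℕ using (ℕ)
open import Data.Nat.Primality using (Prime)
open import Data.Product using (∃)
open import Relation.Binary.PropositionalEquality using (_≡_)

module Naturals where
  open import Data.Nat
    using (ℕ; zero; suc; _+_; _*_; _^_; _∸_; _≤_; _<_; s≤s; z≤n; NonZero; >-nonZero; nonTrivial⇒n>1)
  open import Data.Nat.Properties
  open import Data.Nat.Divisibility
  open import Data.Nat.Primality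
  open import Data.Nat.Coprimality using (Coprime; coprime-divisor)
  open import Data.Nat.Induction using (<-wellFounded)
  open import Data.Nat.Tactic.RingSolver using (solve-∀)
  open import Induction.WellFounded using (Acc; acc)
  open import Data.Sum using (inj₁; inj₂)
  open import Data.Product using (_,_)
  open import Relation.Binary.PropositionalEquality
  open import Relation.Nullary using (¬_; yes; no; contradiction)
  open import Relation.Binary.Core using (Rel)
  open import Relation.Binary.Definitions using (Reflexive; Transitive)

  ^-distribʳ-* : ∀ m n o → (m * n) ^ o ≡ m ^ o * n ^ o
  ^-distribʳ-* m n zero    = refl
  ^-distribʳ-* m n (suc o) =
    trans (cong (m * n *_) (^-distribʳ-* m n o)) (interchange m n (m ^ o) (n ^ o))
    where
    interchange : ∀ a b c d → a * b * (c * d) ≡ a * c * (b * d)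
    interchange = solve-∀

  ^-monoʳ-∣ : ∀ m {n o} → n ≤ o → m ^ n ∣ m ^ o
  ^-monoʳ-∣ m {n} {o} n≤o = divides (m ^ (o ∸ n)) (begin
    m ^ o                 ≡⟨ cong (m ^_) (m+[n∸m]≡n n≤o) ⟨
    m ^ (n + (o ∸ n))     ≡⟨ ^-distribˡ-+-* m n (o ∸ n) ⟩
    m ^ n * m ^ (o ∸ n)   ≡⟨ *-comm (m ^ n) (m ^ (o ∸ n)) ⟩
    m ^ (o ∸ n) * m ^ n   ∎)
    where open ≡-Reasoning

  prime∤⇒coprime : ∀ {q m} → Prime q → ¬ q ∣ m → Coprime m q
  prime∤⇒coprime pq q∤m (c∣m , c∣q) with prime⇒irreducible pq c∣q
  ... | inj₁ c≡1 = c≡1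
  ... | inj₂ refl = contradiction c∣m q∤m

  coprime∧∣*^⇒∣ : ∀ {m q} → Coprime m q → ∀ n e → m ∣ n * q ^ e → m ∣ n
  coprime∧∣*^⇒∣ m⊥q n zero    m∣n*1   = subst (_ ∣_) (*-identityʳ n) m∣n*1
  coprime∧∣*^⇒∣ {m} {q} m⊥q n (suc e) m∣n*qqᵉ =
    coprime∧∣*^⇒∣ m⊥q n e (coprime-divisor m⊥q (subst (m ∣_) (swap n q (q ^ e)) m∣n*qqᵉ))
    where
    swap : ∀ a b c → a * (b * c) ≡ b * (a * c)
    swap = solve-∀

  m+n≤m*n : ∀ {m n} → 1 < m → 1 < n → m + n ≤ m * n
  m+n≤m*n {suc (suc a)} {suc (suc b)} (s≤s (s≤s z≤n)) (s≤s (s≤s z≤n)) =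
    subst (2 + a + (2 + b) ≤_) (sym (expand a b)) (m≤m+n _ _)
    where
    expand : ∀ a b → (2 + a) * (2 + b) ≡ 2 + a + (2 + b) + (a + b + a * b)
    expand = solve-∀

  ∣^-self : ∀ {d} m → .{{NonZero m}} → (∀ {q} → Prime q → q ∣ m → q ∣ d) → m ∣ d ^ m
  ∣^-self {d} m = go m (<-wellFounded m)
    where
    go : ∀ m → Acc _<_ m → .{{NonZero m}} → (∀ {q} → Prime q → q ∣ m → q ∣ d) → m ∣ d ^ m
    go 1 _ _ = 1∣ _
    go m@(suc (suc _)) (acc smaller) factors∣d with prime? m
    ... | yes m-prime = ∣-trans (factors∣d m-prime ∣-refl) (m∣m*n _)
    ... | no ¬m-prime with ¬prime⇒composite ¬m-prime
    ... | hasNonTrivialDivisor {c} c<m c∣m = begin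
      m                    ≡⟨ m∣n⇒n≡quotient*m c∣m ⟩
      e * c                ∣⟨ *-pres-∣ e∣dᵉ c∣dᶜ ⟩
      d ^ e * d ^ c        ≡⟨ ^-distribˡ-+-* d e c ⟨
      d ^ (e + c)          ∣⟨ ^-monoʳ-∣ d e+c≤m ⟩
      d ^ m                ∎
      where
      open ∣-Reasoning
      e = quotient c∣m
      1<c : 1 < c
      1<c = nonTrivial⇒n>1 c
      1<e : 1 < e
      1<e = quotient>1 c∣m c<m
      e∣dᵉ : e ∣ d ^ e
      e∣dᵉ = go e (smaller (quotient-< c∣m)) {{>-nonZero (<-trans (s≤s z≤n) 1<e)}}
               λ q-prime q∣e → factors∣d q-prime (∣-trans q∣e (quotient-∣ c∣m))
      c∣dᶜ : c ∣ d ^ c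
      c∣dᶜ = go c (smaller c<m) {{>-nonZero (<-trans (s≤s z≤n) 1<c)}}
               λ q-prime q∣c → factors∣d q-prime (∣-trans q∣c c∣m)
      e+c≤m : e + c ≤ m
      e+c≤m = subst (e + c ≤_) (sym (m∣n⇒n≡quotient*m c∣m)) (m+n≤m*n 1<e 1<c)

  module _ {a ℓ} {A : Set a} (_≲_ : Rel A ℓ) (≲-refl : Reflexive _≲_) (≲-trans : Transitive _≲_) where
    mono-by-steps : (f : ℕ → A) → (∀ n → f n ≲ f (suc n)) → ∀ {m n} → m ≤ n → f m ≲ f n
    mono-by-steps f step {m} {zero}  z≤n = ≲-refl
    mono-by-steps f step {m} {suc n} m≤1+n with m≤n⇒m<n∨m≡n m≤1+n
    ... | inj₁ (s≤s m≤n) = ≲-trans (mono-by-steps f step m≤n) (step n)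
    ... | inj₂ refl      = ≲-refl

module Rationals where
  open import Data.Nat as ℕ using (ℕ; zero; suc; NonZero)
  import Data.Nat.Properties as ℕ
  open import Data.Integer as ℤ using (+_)
  import Data.Integer.Properties as ℤ
  open import Data.Integer.Tactic.RingSolver using (solve-∀)
  open import Data.Rational hiding (NonZero)
  open import Data.Rational.Properties
  import Data.Rational.Unnormalised as ℚᵘ
  import Data.Rational.Unnormalised.Properties as ℚᵘ
  open import Data.Rational.Solver using (module +-*-Solver)
  open import Data.Product using (∃; _,_)
  open import Data.Nat.Tactic.RingSolver using () renaming (solve-∀ to ℕ-solve-∀)
  open import Relation.Binary.PropositionalEquality
  open +-*-Solver using (solve; _:+_; _:*_; _:=_; con)
  open Naturals using (mono-by-steps)

  fromℕ : ℕ → ℚ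
  fromℕ n = + n / 1

  1/ₙ_ : (n : ℕ) → .{{NonZero n}} → ℚ
  1/ₙ n = + 1 / n

  fromℕ-nonNeg : ∀ n → 0ℚ ≤ fromℕ n
  fromℕ-nonNeg n = nonNegative⁻¹ (fromℕ n) {{normalize-nonNeg n 1}}

  1/ₙ-nonNeg : ∀ n .{{_ : NonZero n}} → 0ℚ ≤ 1/ₙ n
  1/ₙ-nonNeg n = nonNegative⁻¹ (1/ₙ n) {{normalize-nonNeg 1 n}}

  0≤r⇒*-monoˡ-≤ : ∀ {r p q} → 0ℚ ≤ r → p ≤ q → r * p ≤ r * q
  0≤r⇒*-monoˡ-≤ {r} 0≤r = *-monoˡ-≤-nonNeg r {{nonNegative 0≤r}}

  *-nonNeg : ∀ {p q} → 0ℚ ≤ p → 0ℚ ≤ q → 0ℚ ≤ p * q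
  *-nonNeg {p} 0≤p 0≤q = subst (_≤ p * _) (*-zeroʳ p) (0≤r⇒*-monoˡ-≤ 0≤p 0≤q)

  0≤q⇒p≤p+q : ∀ {p q} → 0ℚ ≤ q → p ≤ p + q
  0≤q⇒p≤p+q {p} 0≤q = subst (_≤ p + _) (+-identityʳ p) (+-monoʳ-≤ p 0≤q)

  private
    toℚᵘ-/ : ∀ i n .{{_ : NonZero n}} → toℚᵘ (i / n) ℚᵘ.≃ (i ℚᵘ./ n)
    toℚᵘ-/ i (suc n) = toℚᵘ-fromℚᵘ (ℚᵘ.mkℚᵘ i n)

    toℚᵘ-fromℕ : ∀ n → toℚᵘ (fromℕ n) ℚᵘ.≃ (+ n ℚᵘ./ 1)
    toℚᵘ-fromℕ n = toℚᵘ-/ (+ n) 1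

  module _ where
    open ℚᵘ.≃-Reasoning

    fromℕ-+ : ∀ m n → fromℕ (m ℕ.+ n) ≡ fromℕ m + fromℕ n
    fromℕ-+ m n = toℚᵘ-injective (begin
      toℚᵘ (fromℕ (m ℕ.+ n))                 ≈⟨ toℚᵘ-fromℕ (m ℕ.+ n) ⟩
      + (m ℕ.+ n) ℚᵘ./ 1                      ≈⟨ ℚᵘ.*≡* (trans (cong (ℤ._* + 1) (ℤ.pos-+ m n)) (lemma (+ m) (+ n))) ⟩
      (+ m ℚᵘ./ 1) ℚᵘ.+ (+ n ℚᵘ./ 1)          ≈⟨ ℚᵘ.+-cong (toℚᵘ-fromℕ m) (toℚᵘ-fromℕ n) ⟨
      toℚᵘ (fromℕ m) ℚᵘ.+ toℚᵘ (fromℕ n)      ≈⟨ toℚᵘ-homo-+ (fromℕ m) (fromℕ n) ⟨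
      toℚᵘ (fromℕ m + fromℕ n)                ∎)
      where
      lemma : ∀ a b → (a ℤ.+ b) ℤ.* + 1 ≡ (a ℤ.* + 1 ℤ.+ b ℤ.* + 1) ℤ.* + 1
      lemma = solve-∀

    fromℕ-* : ∀ m n → fromℕ (m ℕ.* n) ≡ fromℕ m * fromℕ n
    fromℕ-* m n = toℚᵘ-injective (begin
      toℚᵘ (fromℕ (m ℕ.* n))                 ≈⟨ toℚᵘ-fromℕ (m ℕ.* n) ⟩
      + (m ℕ.* n) ℚᵘ./ 1                      ≈⟨ ℚᵘ.*≡* (cong (ℤ._* + 1) (ℤ.pos-* m n)) ⟩
      (+ m ℚᵘ./ 1) ℚᵘ.* (+ n ℚᵘ./ 1)          ≈⟨ ℚᵘ.*-cong (toℚᵘ-fromℕ m) (toℚᵘ-fromℕ n) ⟨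
      toℚᵘ (fromℕ m) ℚᵘ.* toℚᵘ (fromℕ n)      ≈⟨ toℚᵘ-homo-* (fromℕ m) (fromℕ n) ⟨
      toℚᵘ (fromℕ m * fromℕ n)                ∎)

    1/ₙ-* : ∀ m n .{{_ : NonZero m}} .{{_ : NonZero n}} →
            (1/ₙ (m ℕ.* n)) {{ℕ.m*n≢0 m n}} ≡ 1/ₙ m * 1/ₙ n
    1/ₙ-* m@(suc _) n@(suc _) = toℚᵘ-injective (begin
      toℚᵘ (1/ₙ (m ℕ.* n))                    ≈⟨ toℚᵘ-/ (+ 1) (m ℕ.* n) ⟩
      + 1 ℚᵘ./ (m ℕ.* n)                       ≈⟨ ℚᵘ.≃-refl ⟩
      (+ 1 ℚᵘ./ m) ℚᵘ.* (+ 1 ℚᵘ./ n)           ≈⟨ ℚᵘ.*-cong (toℚᵘ-/ (+ 1) m) (toℚᵘ-/ (+ 1) n) ⟨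
      toℚᵘ (1/ₙ m) ℚᵘ.* toℚᵘ (1/ₙ n)           ≈⟨ toℚᵘ-homo-* (1/ₙ m) (1/ₙ n) ⟨
      toℚᵘ (1/ₙ m * 1/ₙ n)                     ∎)

    /≡fromℕ*1/ₙ : ∀ m n .{{_ : NonZero n}} → + m / n ≡ fromℕ m * 1/ₙ n
    /≡fromℕ*1/ₙ m n@(suc n-1) = toℚᵘ-injective (begin
      toℚᵘ (+ m / n)                          ≈⟨ toℚᵘ-/ (+ m) n ⟩
      + m ℚᵘ./ n                              ≈⟨ ℚᵘ.*≡* (lemma (+ m) (cong (λ d → + suc d) (ℕ.+-identityʳ n-1))) ⟩
      (+ m ℚᵘ./ 1) ℚᵘ.* (+ 1 ℚᵘ./ n)          ≈⟨ ℚᵘ.*-cong (toℚᵘ-fromℕ m) (toℚᵘ-/ (+ 1) n) ⟨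
      toℚᵘ (fromℕ m) ℚᵘ.* toℚᵘ (1/ₙ n)        ≈⟨ toℚᵘ-homo-* (fromℕ m) (1/ₙ n) ⟨
      toℚᵘ (fromℕ m * 1/ₙ n)                  ∎)
      where
      lemma : ∀ a {d e} → d ≡ e → a ℤ.* d ≡ (a ℤ.* + 1) ℤ.* e
      lemma a {d} refl = cong (ℤ._* d) (sym (ℤ.*-identityʳ a))

    fromℕ*1/ₙ≡1 : ∀ n .{{_ : NonZero n}} → fromℕ n * 1/ₙ n ≡ 1ℚ
    fromℕ*1/ₙ≡1 n@(suc n-1) = trans (sym (/≡fromℕ*1/ₙ n n)) (toℚᵘ-injective (begin
      toℚᵘ (+ n / n)                          ≈⟨ toℚᵘ-/ (+ n) n ⟩
      + n ℚᵘ./ n                              ≈⟨ ℚᵘ.*≡* (trans (ℤ.*-identityʳ (+ n)) (sym (ℤ.*-identityˡ (+ n)))) ⟩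
      ℚᵘ.1ℚᵘ                                  ∎))

  /-mono-≤ : ∀ {a b c d} .{{_ : NonZero b}} .{{_ : NonZero d}} →
             a ℕ.* d ℕ.≤ c ℕ.* b → + a / b ≤ + c / d
  /-mono-≤ {a} {b@(suc _)} {c} {d@(suc _)} ad≤cb = toℚᵘ-cancel-≤
    (ℚᵘ.≤-respˡ-≃ (ℚᵘ.≃-sym (toℚᵘ-/ (+ a) b)) (ℚᵘ.≤-respʳ-≃ (ℚᵘ.≃-sym (toℚᵘ-/ (+ c) d))
      (ℚᵘ.*≤* (subst₂ ℤ._≤_ (ℤ.pos-* a d) (ℤ.pos-* c b) (ℤ.+≤+ ad≤cb)))))

  fromℕ-mono-≤ : ∀ {m n} → m ℕ.≤ n → fromℕ m ≤ fromℕ n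
  fromℕ-mono-≤ {m} {n} m≤n =
    /-mono-≤ {m} {1} {n} {1} (subst₂ ℕ._≤_ (sym (ℕ.*-identityʳ m)) (sym (ℕ.*-identityʳ n)) m≤n)

  1/ₙ≤fromℕ*1/ₙ : ∀ a b c .{{_ : NonZero b}} .{{_ : NonZero c}} →
                  b ℕ.≤ a ℕ.* c → 1/ₙ c ≤ fromℕ a * 1/ₙ b
  1/ₙ≤fromℕ*1/ₙ a b c b≤ac = subst (1/ₙ c ≤_) (/≡fromℕ*1/ₙ a b)
    (/-mono-≤ {1} {c} {a} {b} (subst (ℕ._≤ a ℕ.* c) (sym (ℕ.*-identityˡ b)) b≤ac))

  1/ₙ-antitone : ∀ {m n} .{{_ : NonZero m}} .{{_ : NonZero n}} → m ℕ.≤ n → 1/ₙ n ≤ 1/ₙ m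
  1/ₙ-antitone {m} {n} m≤n =
    /-mono-≤ {1} {n} {1} {m} (subst₂ ℕ._≤_ (sym (ℕ.*-identityˡ m)) (sym (ℕ.*-identityˡ n)) m≤n)

  H : ℕ → ℚ
  H zero    = 0ℚ
  H (suc n) = H n + 1/ₙ suc n

  H-mono-≤ : ∀ {m n} → m ℕ.≤ n → H m ≤ H n
  H-mono-≤ = mono-by-steps _≤_ ≤-refl ≤-trans H λ n → 0≤q⇒p≤p+q (1/ₙ-nonNeg (suc n))

  H-gap : ∀ t n → H n + fromℕ t * 1/ₙ suc (t ℕ.+ n) ≤ H (t ℕ.+ n)
  H-gap zero    n = ≤-reflexive (trans (cong (_+_ (H n)) (*-zeroˡ (1/ₙ suc n))) (+-identityʳ (H n)))
  H-gap (suc t) n = begin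
    H n + fromℕ (suc t) * 1/ₙ suc (suc t ℕ.+ n)
      ≤⟨ +-monoʳ-≤ (H n) (0≤r⇒*-monoˡ-≤ (fromℕ-nonNeg (suc t)) (1/ₙ-antitone {suc (t ℕ.+ n)} (ℕ.n≤1+n _))) ⟩
    H n + fromℕ (suc t) * v                            ≡⟨ cong (λ x → H n + x * v) (fromℕ-+ 1 t) ⟩
    H n + (1ℚ + fromℕ t) * v                           ≡⟨ regroup (H n) (fromℕ t) v ⟩
    H n + fromℕ t * v + v                              ≤⟨ +-monoˡ-≤ v (H-gap t n) ⟩
    H (t ℕ.+ n) + v                                    ∎
    where
    open ≤-Reasoning
    v = 1/ₙ suc (t ℕ.+ n)
    regroup : ∀ h a v → h + (1ℚ + a) * v ≡ h + a * v + v
    regroup = solve 3 (λ h a v → h :+ (con 1ℚ :+ a) :* v := h :+ a :* v :+ v) refl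

  H-double : ∀ n .{{_ : NonZero n}} → H n + 1/ₙ 3 ≤ H (n ℕ.+ n)
  H-double n@(suc m) = ≤-trans (+-monoʳ-≤ (H n) (1/ₙ≤fromℕ*1/ₙ n (suc (n ℕ.+ n)) 3 2n+1≤3n)) (H-gap n n)
    where
    expand : ∀ m → suc m ℕ.* 3 ≡ suc (suc m ℕ.+ suc m) ℕ.+ m
    expand = ℕ-solve-∀
    2n+1≤3n : suc (n ℕ.+ n) ℕ.≤ n ℕ.* 3
    2n+1≤3n = subst (suc (n ℕ.+ n) ℕ.≤_) (sym (expand m)) (ℕ.m≤m+n _ m)

  H-2^ : ∀ j → fromℕ j * 1/ₙ 3 ≤ H (2 ℕ.^ j)
  H-2^ zero    = *≤* (ℤ.+≤+ ℕ.z≤n)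
  H-2^ (suc j) = begin
    fromℕ (suc j) * 1/ₙ 3          ≡⟨ cong (_* 1/ₙ 3) (fromℕ-+ 1 j) ⟩
    (1ℚ + fromℕ j) * 1/ₙ 3         ≡⟨ distrib (fromℕ j) (1/ₙ 3) ⟩
    fromℕ j * 1/ₙ 3 + 1/ₙ 3        ≤⟨ +-monoˡ-≤ (1/ₙ 3) (H-2^ j) ⟩
    H (2 ℕ.^ j) + 1/ₙ 3            ≤⟨ H-double (2 ℕ.^ j) {{ℕ.m^n≢0 2 j}} ⟩
    H (2 ℕ.^ j ℕ.+ 2 ℕ.^ j)        ≡⟨ cong (λ x → H (2 ℕ.^ j ℕ.+ x)) (ℕ.+-identityʳ (2 ℕ.^ j)) ⟨
    H (2 ℕ.^ suc j)                ∎
    where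
    open ≤-Reasoning
    distrib : ∀ a v → (1ℚ + a) * v ≡ a * v + v
    distrib = solve 2 (λ a v → (con 1ℚ :+ a) :* v := a :* v :+ v) refl

  H-unbounded : ∀ B → fromℕ B ≤ H (2 ℕ.^ (B ℕ.* 3))
  H-unbounded B = subst (_≤ H (2 ℕ.^ (B ℕ.* 3))) B*3/3≡B (H-2^ (B ℕ.* 3))
    where
    open ≡-Reasoning
    B*3/3≡B : fromℕ (B ℕ.* 3) * 1/ₙ 3 ≡ fromℕ B
    B*3/3≡B = begin
      fromℕ (B ℕ.* 3) * 1/ₙ 3        ≡⟨ cong (_* 1/ₙ 3) (fromℕ-* B 3) ⟩
      fromℕ B * fromℕ 3 * 1/ₙ 3      ≡⟨ *-assoc (fromℕ B) (fromℕ 3) (1/ₙ 3) ⟩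
      fromℕ B * (fromℕ 3 * 1/ₙ 3)    ≡⟨ cong (fromℕ B *_) (fromℕ*1/ₙ≡1 3) ⟩
      fromℕ B * 1ℚ                   ≡⟨ *-identityʳ (fromℕ B) ⟩
      fromℕ B                        ∎

  archimedean : ∀ ε → 0ℚ < ε → ∃ λ B → 1ℚ < ε * fromℕ B
  archimedean (mkℚ (+ zero) _ _) 0<ε with positive 0<ε
  ... | record { pos = () }
  archimedean (mkℚ ℤ.-[1+ _ ] _ _) 0<ε with positive 0<ε
  ... | record { pos = () }
  archimedean ε@(mkℚ (+ suc a) b-1 _) _ = suc b-1 ℕ.+ suc b-1 , (begin-strict
    1ℚ                                   <⟨ *<* (ℤ.+<+ (ℕ.s≤s (ℕ.s≤s ℕ.z≤n))) ⟩
    1ℚ + 1ℚ                              ≤⟨ +-mono-≤ 1≤1+a 1≤1+a ⟩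
    fromℕ (suc a) + fromℕ (suc a)        ≡⟨ cong₂ _+_ ε*d≡1+a ε*d≡1+a ⟨
    ε * fromℕ d + ε * fromℕ d            ≡⟨ *-distribˡ-+ ε (fromℕ d) (fromℕ d) ⟨
    ε * (fromℕ d + fromℕ d)              ≡⟨ cong (ε *_) (fromℕ-+ d d) ⟨
    ε * fromℕ (d ℕ.+ d)                  ∎)
    where
    open ≤-Reasoning
    d = suc b-1
    1≤1+a : 1ℚ ≤ fromℕ (suc a)
    1≤1+a = fromℕ-mono-≤ (ℕ.s≤s (ℕ.z≤n {a}))
    ε*d≡1+a : ε * fromℕ d ≡ fromℕ (suc a)
    ε*d≡1+a = begin-equality
      ε * fromℕ d                            ≡⟨ cong (_* fromℕ d) (sym (↥p/↧p≡p ε)) ⟩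
      + suc a / d * fromℕ d                  ≡⟨ cong (_* fromℕ d) (/≡fromℕ*1/ₙ (suc a) d) ⟩
      fromℕ (suc a) * 1/ₙ d * fromℕ d        ≡⟨ *-assoc (fromℕ (suc a)) (1/ₙ d) (fromℕ d) ⟩
      fromℕ (suc a) * (1/ₙ d * fromℕ d)      ≡⟨ cong (fromℕ (suc a) *_) (*-comm (1/ₙ d) (fromℕ d)) ⟩
      fromℕ (suc a) * (fromℕ d * 1/ₙ d)      ≡⟨ cong (fromℕ (suc a) *_) (fromℕ*1/ₙ≡1 d) ⟩
      fromℕ (suc a) * 1ℚ                     ≡⟨ *-identityʳ (fromℕ (suc a)) ⟩
      fromℕ (suc a)                          ∎

module EulerProduct (p : ℕ → ℕ) (pr : ∀ i → Prime (p i)) where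
  open import Data.Nat as ℕ using (ℕ; zero; suc; _∸_; NonZero)
  import Data.Nat.Properties as ℕ
  open import Data.Nat.Divisibility using (_∣_; _∣?_; divides; ∣1⇒≡1; 1∣_; m*n∣⇒m∣; ∣m⇒∣m*n; n∣m*n)
  open import Data.Nat.Primality using (Prime; prime⇒nonZero; prime⇒nonTrivial)
  open import Data.Rational hiding (NonZero)
  open import Data.Rational.Properties
  open import Data.Rational.Solver using (module +-*-Solver)
  open import Relation.Binary.PropositionalEquality
  open import Function using (flip)
  open import Data.Integer as ℤ using (+_)
  open import Relation.Nullary using (¬_; yes; no; contradiction)
  open import Data.Sum using (inj₁; inj₂)
  open +-*-Solver using (solve; _:+_; _:*_; _:-_; :-_; _:=_; con)
  open import Defs
  open Naturals
  open Rationals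

  instance
    p-nonZero : ∀ {i} → NonZero (p i)
    p-nonZero {i} = prime⇒nonZero (pr i)

  primorial : ℕ → ℕ
  primorial zero    = 1
  primorial (suc k) = primorial k ℕ.* p k

  primorial-nonZero : ∀ k → NonZero (primorial k)
  primorial-nonZero zero    = _
  primorial-nonZero (suc k) = ℕ.m*n≢0 (primorial k) (p k) {{primorial-nonZero k}}

  1/primorial : ℕ → ℚ
  1/primorial k = (1/ₙ primorial k) {{primorial-nonZero k}}

  1/primorial-suc : ∀ k → 1/primorial (suc k) ≡ 1/primorial k * 1/ₙ p k
  1/primorial-suc k = 1/ₙ-* (primorial k) (p k) {{primorial-nonZero k}}

  density : ℕ → ℚ
  density zero    = 1ℚ
  density (suc k) = density k * (1ℚ - 1/ₙ p k)

  1<p : ∀ i → 1 ℕ.< p i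
  1<p i = ℕ.nonTrivial⇒n>1 (p i) {{prime⇒nonTrivial (pr i)}}

  [p-1]/p≡1-1/p : ∀ k → fromℕ (p k ∸ 1) * 1/ₙ p k ≡ 1ℚ - 1/ₙ p k
  [p-1]/p≡1-1/p k = begin
    fromℕ (p k ∸ 1) * 1/ₙ p k                 ≡⟨ x*u≡[x+1]*u-u (fromℕ (p k ∸ 1)) (1/ₙ p k) ⟩
    (fromℕ (p k ∸ 1) + 1ℚ) * 1/ₙ p k - 1/ₙ p k ≡⟨ cong (λ x → x * 1/ₙ p k - 1/ₙ p k) p-1+1≡p ⟩
    fromℕ (p k) * 1/ₙ p k - 1/ₙ p k             ≡⟨ cong (_- 1/ₙ p k) (fromℕ*1/ₙ≡1 (p k)) ⟩
    1ℚ - 1/ₙ p k                                ∎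
    where
    open ≡-Reasoning
    x*u≡[x+1]*u-u : ∀ x u → x * u ≡ (x + 1ℚ) * u - u
    x*u≡[x+1]*u-u = solve 2 (λ x u → x :* u := (x :+ con 1ℚ) :* u :- u) refl
    p-1+1≡p : fromℕ (p k ∸ 1) + 1ℚ ≡ fromℕ (p k)
    p-1+1≡p = trans (sym (fromℕ-+ (p k ∸ 1) 1)) (cong fromℕ (ℕ.m∸n+n≡m (ℕ.<⇒≤ (1<p k))))

  1-1/p-nonNeg : ∀ k → 0ℚ ≤ 1ℚ - 1/ₙ p k
  1-1/p-nonNeg k =
    subst (0ℚ ≤_) ([p-1]/p≡1-1/p k) (*-nonNeg (fromℕ-nonNeg (p k ∸ 1)) (1/ₙ-nonNeg (p k)))

  1-1/p≤1 : ∀ k → 1ℚ - 1/ₙ p k ≤ 1ℚ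
  1-1/p≤1 k = subst₂ _≤_ (+-identityʳ (1ℚ - 1/ₙ p k)) (x-u+u≡x 1ℚ (1/ₙ p k))
                (+-monoʳ-≤ (1ℚ - 1/ₙ p k) (1/ₙ-nonNeg (p k)))
    where
    x-u+u≡x : ∀ x u → x - u + u ≡ x
    x-u+u≡x = solve 2 (λ x u → x :- u :+ u := x) refl

  density-nonNeg : ∀ k → 0ℚ ≤ density k
  density-nonNeg zero    = *≤* (ℤ.+≤+ ℕ.z≤n)
  density-nonNeg (suc k) = *-nonNeg (density-nonNeg k) (1-1/p-nonNeg k)

  density-antitone : ∀ {m n} → m ℕ.≤ n → density n ≤ density m
  density-antitone = mono-by-steps (flip _≤_) ≤-refl (flip ≤-trans) density density-step
    where
    density-step : ∀ k → density (suc k) ≤ density k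
    density-step k = subst (density (suc k) ≤_) (*-identityʳ (density k))
                       (0≤r⇒*-monoˡ-≤ (density-nonNeg k) (1-1/p≤1 k))

  density≡numer*1/primorial : ∀ k → density k ≡ fromℕ (numer p k) * 1/primorial k
  density≡numer*1/primorial zero    = refl
  density≡numer*1/primorial (suc k) = begin
    density k * (1ℚ - 1/ₙ p k)
      ≡⟨ cong₂ _*_ (density≡numer*1/primorial k) (sym ([p-1]/p≡1-1/p k)) ⟩
    fromℕ (numer p k) * 1/primorial k * (fromℕ (p k ∸ 1) * 1/ₙ p k)
      ≡⟨ interchange (fromℕ (numer p k)) (1/primorial k) (fromℕ (p k ∸ 1)) (1/ₙ p k) ⟩
    fromℕ (numer p k) * fromℕ (p k ∸ 1) * (1/primorial k * 1/ₙ p k)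
      ≡⟨ cong₂ _*_ (fromℕ-* (numer p k) (p k ∸ 1)) (1/primorial-suc k) ⟨
    fromℕ (numer p (suc k)) * 1/primorial (suc k)
      ∎
    where
    open ≡-Reasoning
    interchange : ∀ a b c d → a * b * (c * d) ≡ a * c * (b * d)
    interchange = solve 4 (λ a b c d → a :* b :* (c :* d) := a :* c :* (b :* d)) refl

  denom≡primorial : ∀ k → denom p k ≡ primorial (suc k)
  denom≡primorial zero    = sym (ℕ.*-identityˡ (p 0))
  denom≡primorial (suc k) = cong (ℕ._* p (suc k)) (denom≡primorial k)

  T≡density*1/p : ∀ k → T p pr k ≡ density k * 1/ₙ p k
  T≡density*1/p k = begin
    T p pr k
      ≡⟨ /-cong {+ numer p k} {{denom-nonZero p pr k}} {{primorial-nonZero (suc k)}} refl (denom≡primorial k) ⟩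
    (+ numer p k / primorial (suc k)) {{primorial-nonZero (suc k)}}
      ≡⟨ /≡fromℕ*1/ₙ (numer p k) (primorial (suc k)) {{primorial-nonZero (suc k)}} ⟩
    fromℕ (numer p k) * 1/primorial (suc k)
      ≡⟨ cong (fromℕ (numer p k) *_) (1/primorial-suc k) ⟩
    fromℕ (numer p k) * (1/primorial k * 1/ₙ p k)
      ≡⟨ *-assoc (fromℕ (numer p k)) (1/primorial k) (1/ₙ p k) ⟨
    fromℕ (numer p k) * 1/primorial k * 1/ₙ p k
      ≡⟨ cong (_* 1/ₙ p k) (density≡numer*1/primorial k) ⟨
    density k * 1/ₙ p k
      ∎
    where open ≡-Reasoning

  S+density≡1 : ∀ n → S p pr n + density n ≡ 1ℚ
  S+density≡1 zero    = refl
  S+density≡1 (suc n) = begin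
    S p pr n + T p pr n + density n * (1ℚ - 1/ₙ p n)
      ≡⟨ cong (λ t → S p pr n + t + density n * (1ℚ - 1/ₙ p n)) (T≡density*1/p n) ⟩
    S p pr n + density n * 1/ₙ p n + density n * (1ℚ - 1/ₙ p n)
      ≡⟨ telescope (S p pr n) (density n) (1/ₙ p n) ⟩
    S p pr n + density n
      ≡⟨ S+density≡1 n ⟩
    1ℚ
      ∎
    where
    open ≡-Reasoning
    telescope : ∀ s r u → s + r * u + r * (1ℚ - u) ≡ s + r
    telescope = solve 3 (λ s r u → s :+ r :* u :+ r :* (con 1ℚ :- u) := s :+ r) refl

  ∣S-1∣≡density : ∀ n → ∣ S p pr n - 1ℚ ∣ ≡ density n
  ∣S-1∣≡density n = begin
    ∣ S p pr n - 1ℚ ∣                     ≡⟨ cong (λ x → ∣ S p pr n - x ∣) (S+density≡1 n) ⟨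
    ∣ S p pr n - (S p pr n + density n) ∣ ≡⟨ cong ∣_∣ (cancel (S p pr n) (density n)) ⟩
    ∣ - density n ∣                       ≡⟨ ∣-p∣≡∣p∣ (density n) ⟩
    ∣ density n ∣                         ≡⟨ 0≤p⇒∣p∣≡p (density-nonNeg n) ⟩
    density n                             ∎
    where
    open ≡-Reasoning
    cancel : ∀ s r → s - (s + r) ≡ - r
    cancel = solve 2 (λ s r → s :- (s :+ r) := :- r) refl

  -- "n ∣ primorial k ^ E" stands in for "all prime factors of n are among p 0, …, p (k-1)";
  -- the two agree for n ≤ E, which is all that smoothH≡H uses.
  module SmoothHarmonic (E : ℕ) where

    smoothRecip : ℕ → ℕ → ℚ
    smoothRecip k zero = 0ℚ
    smoothRecip k n@(suc _) with n ∣? primorial k ℕ.^ E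
    ... | yes _ = 1/ₙ n
    ... | no  _ = 0ℚ

    smoothH : ℕ → ℕ → ℚ
    smoothH k zero    = 0ℚ
    smoothH k (suc x) = smoothH k x + smoothRecip k (suc x)

    smoothRecip-∣ : ∀ {k} n .{{_ : NonZero n}} → n ∣ primorial k ℕ.^ E → smoothRecip k n ≡ 1/ₙ n
    smoothRecip-∣ {k} n@(suc _) n∣P with n ∣? primorial k ℕ.^ E
    ... | yes _  = refl
    ... | no n∤P = contradiction n∣P n∤P

    smoothRecip-∤ : ∀ {k} n → ¬ n ∣ primorial k ℕ.^ E → smoothRecip k n ≡ 0ℚ
    smoothRecip-∤     zero      _   = refl
    smoothRecip-∤ {k} n@(suc _) n∤P with n ∣? primorial k ℕ.^ E
    ... | yes n∣P = contradiction n∣P n∤P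
    ... | no _    = refl

    smoothRecip-nonNeg : ∀ k n → 0ℚ ≤ smoothRecip k n
    smoothRecip-nonNeg k zero      = ≤-refl
    smoothRecip-nonNeg k n@(suc _) with n ∣? primorial k ℕ.^ E
    ... | yes _ = 1/ₙ-nonNeg n
    ... | no  _ = ≤-refl

    smoothH-nonNeg : ∀ k x → 0ℚ ≤ smoothH k x
    smoothH-nonNeg k zero    = ≤-refl
    smoothH-nonNeg k (suc x) = +-mono-≤ (smoothH-nonNeg k x) (smoothRecip-nonNeg k (suc x))

    smoothH-mono-≤ : ∀ k {x y} → x ℕ.≤ y → smoothH k x ≤ smoothH k y
    smoothH-mono-≤ k =
      mono-by-steps _≤_ ≤-refl ≤-trans (smoothH k) λ x → 0≤q⇒p≤p+q (smoothRecip-nonNeg k (suc x))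

    smoothH[0]≤1 : ∀ x → smoothH 0 x ≤ 1ℚ
    smoothH[0]≤1 zero    = *≤* (ℤ.+≤+ ℕ.z≤n)
    smoothH[0]≤1 (suc x) = ≤-reflexive (smoothH[0,1+x]≡1 x)
      where
      smoothH[0,1+x]≡1 : ∀ x → smoothH 0 (suc x) ≡ 1ℚ
      smoothH[0,1+x]≡1 zero    = trans (+-identityˡ _) (smoothRecip-∣ 1 (1∣ _))
      smoothH[0,1+x]≡1 (suc x) =
        trans (cong₂ _+_ (smoothH[0,1+x]≡1 x) (smoothRecip-∤ (suc (suc x)) 2+x∤1)) (+-identityʳ 1ℚ)
        where
        2+x∤1 : ¬ suc (suc x) ∣ 1 ℕ.^ E
        2+x∤1 2+x∣1 with () ← ∣1⇒≡1 (subst (suc (suc x) ∣_) (ℕ.^-zeroˡ E) 2+x∣1)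

    smoothRecip-coprime : ∀ {k} n → ¬ p k ∣ n → smoothRecip (suc k) n ≤ smoothRecip k n
    smoothRecip-coprime {k} zero      _   = ≤-refl
    smoothRecip-coprime {k} n@(suc _) p∤n with n ∣? primorial (suc k) ℕ.^ E
    ... | no  _   = smoothRecip-nonNeg k n
    ... | yes n∣P = ≤-reflexive (sym (smoothRecip-∣ n n∣primorial^E))
      where
      n∣primorial^E : n ∣ primorial k ℕ.^ E
      n∣primorial^E = coprime∧∣*^⇒∣ (prime∤⇒coprime (pr k) p∤n) (primorial k ℕ.^ E) E
                        (subst (n ∣_) (^-distribʳ-* (primorial k) (p k) E) n∣P)

    smoothRecip-multiple : ∀ {k} j →
                           smoothRecip (suc k) (j ℕ.* p k) ≤ 1/ₙ p k * smoothRecip (suc k) j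
    smoothRecip-multiple {k} zero = ≤-reflexive (sym (*-zeroʳ (1/ₙ p k)))
    smoothRecip-multiple {k} j@(suc _) with j ℕ.* p k ∣? primorial (suc k) ℕ.^ E
    ... | no jp∤P = subst (_≤ 1/ₙ p k * smoothRecip (suc k) j) (sym (smoothRecip-∤ (j ℕ.* p k) jp∤P))
                      (*-nonNeg (1/ₙ-nonNeg (p k)) (smoothRecip-nonNeg (suc k) j))
    ... | yes jp∣P = ≤-reflexive (begin
      smoothRecip (suc k) (j ℕ.* p k)     ≡⟨ smoothRecip-∣ (j ℕ.* p k) {{ℕ.m*n≢0 j (p k)}} jp∣P ⟩
      (1/ₙ (j ℕ.* p k)) {{ℕ.m*n≢0 j (p k)}} ≡⟨ 1/ₙ-* j (p k) ⟩
      1/ₙ j * 1/ₙ p k                     ≡⟨ *-comm (1/ₙ j) (1/ₙ p k) ⟩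
      1/ₙ p k * 1/ₙ j                     ≡⟨ cong (1/ₙ p k *_) (smoothRecip-∣ j (m*n∣⇒m∣ j (p k) jp∣P)) ⟨
      1/ₙ p k * smoothRecip (suc k) j     ∎)
      where open ≡-Reasoning

    smoothH-split : ∀ k x y → x ℕ.< p k ℕ.* suc y →
                    smoothH (suc k) x ≤ smoothH k x + 1/ₙ p k * smoothH (suc k) y
    smoothH-split k zero    y _ =
      +-monoʳ-≤ 0ℚ (*-nonNeg (1/ₙ-nonNeg (p k)) (smoothH-nonNeg (suc k) y))
    smoothH-split k (suc x) y 1+x<p[1+y] with p k ∣? suc x
    ... | no p∤1+x = begin
      smoothH (suc k) x + smoothRecip (suc k) (suc x)
        ≤⟨ +-mono-≤ (smoothH-split k x y (ℕ.<-trans (ℕ.n<1+n x) 1+x<p[1+y]))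
                    (smoothRecip-coprime (suc x) p∤1+x) ⟩
      smoothH k x + 1/ₙ p k * smoothH (suc k) y + smoothRecip k (suc x)
        ≡⟨ swap (smoothH k x) (1/ₙ p k * smoothH (suc k) y) (smoothRecip k (suc x)) ⟩
      smoothH k (suc x) + 1/ₙ p k * smoothH (suc k) y
        ∎
      where
      open ≤-Reasoning
      swap : ∀ a b c → a + b + c ≡ a + c + b
      swap = solve 3 (λ a b c → a :+ b :+ c := a :+ c :+ b) refl
    ... | yes (divides zero ())
    ... | yes (divides j@(suc j-1) 1+x≡j*p) = begin
      smoothH (suc k) x + smoothRecip (suc k) (suc x)
        ≡⟨ cong (λ n → smoothH (suc k) x + smoothRecip (suc k) n) 1+x≡j*p ⟩
      smoothH (suc k) x + smoothRecip (suc k) (j ℕ.* p k)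
        ≤⟨ +-mono-≤ (smoothH-split k x j-1 x<p*j) (smoothRecip-multiple j) ⟩
      smoothH k x + 1/ₙ p k * smoothH (suc k) j-1 + 1/ₙ p k * smoothRecip (suc k) j
        ≡⟨ +-assoc (smoothH k x) _ _ ⟩
      smoothH k x + (1/ₙ p k * smoothH (suc k) j-1 + 1/ₙ p k * smoothRecip (suc k) j)
        ≡⟨ cong (_+_ (smoothH k x)) (*-distribˡ-+ (1/ₙ p k) (smoothH (suc k) j-1) (smoothRecip (suc k) j)) ⟨
      smoothH k x + 1/ₙ p k * smoothH (suc k) j
        ≤⟨ +-mono-≤ (0≤q⇒p≤p+q {smoothH k x} (smoothRecip-nonNeg k (suc x)))
                    (0≤r⇒*-monoˡ-≤ (1/ₙ-nonNeg (p k)) (smoothH-mono-≤ (suc k) j≤y)) ⟩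
      smoothH k (suc x) + 1/ₙ p k * smoothH (suc k) y
        ∎
      where
      open ≤-Reasoning
      x<p*j : x ℕ.< p k ℕ.* j
      x<p*j = subst (x ℕ.<_) (trans 1+x≡j*p (ℕ.*-comm j (p k))) (ℕ.n<1+n x)
      j≤y : j ℕ.≤ y
      j≤y = ℕ.≤-pred (ℕ.*-cancelʳ-< (p k) j (suc y)
              (subst₂ ℕ._<_ 1+x≡j*p (ℕ.*-comm (p k) (suc y)) 1+x<p[1+y]))

    density*smoothH≤1 : ∀ k x → density k * smoothH k x ≤ 1ℚ
    density*smoothH≤1 zero    x       = subst (_≤ 1ℚ) (sym (*-identityˡ (smoothH 0 x))) (smoothH[0]≤1 x)
    density*smoothH≤1 (suc k) zero    =
      ≤-trans (≤-reflexive (*-zeroʳ (density (suc k)))) (*≤* (ℤ.+≤+ ℕ.z≤n))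
    density*smoothH≤1 (suc k) (suc y) = begin
      density k * (1ℚ - u) * smoothH (suc k) (suc y)
        ≤⟨ 0≤r⇒*-monoˡ-≤ (density-nonNeg (suc k)) (smoothH-split k (suc y) y 1+y<p[1+y]) ⟩
      density k * (1ℚ - u) * (smoothH k (suc y) + u * smoothH (suc k) y)
        ≡⟨ expand (density k) u (smoothH k (suc y)) (smoothH (suc k) y) ⟩
      (1ℚ - u) * (density k * smoothH k (suc y)) + u * (density (suc k) * smoothH (suc k) y)
        ≤⟨ +-mono-≤ (0≤r⇒*-monoˡ-≤ (1-1/p-nonNeg k) (density*smoothH≤1 k (suc y)))
                    (0≤r⇒*-monoˡ-≤ (1/ₙ-nonNeg (p k)) (density*smoothH≤1 (suc k) y)) ⟩
      (1ℚ - u) * 1ℚ + u * 1ℚ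
        ≡⟨ convex u ⟩
      1ℚ
        ∎
      where
      open ≤-Reasoning
      u = 1/ₙ p k
      1+y<p[1+y] : suc y ℕ.< p k ℕ.* suc y
      1+y<p[1+y] = subst (suc y ℕ.<_) (ℕ.*-comm (suc y) (p k)) (ℕ.m<m*n (suc y) (p k) (1<p k))
      expand : ∀ r u f g → r * (1ℚ - u) * (f + u * g) ≡ (1ℚ - u) * (r * f) + u * (r * (1ℚ - u) * g)
      expand = solve 4 (λ r u f g → r :* (con 1ℚ :- u) :* (f :+ u :* g)
                                 := (con 1ℚ :- u) :* (r :* f) :+ u :* (r :* (con 1ℚ :- u) :* g)) refl
      convex : ∀ u → (1ℚ - u) * 1ℚ + u * 1ℚ ≡ 1ℚ
      convex = solve 1 (λ u → (con 1ℚ :- u) :* con 1ℚ :+ u :* con 1ℚ := con 1ℚ) refl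

  p∣primorial : ∀ {i k} → i ℕ.< k → p i ∣ primorial k
  p∣primorial {i} {suc k} i<1+k with ℕ.m≤n⇒m<n∨m≡n (ℕ.≤-pred i<1+k)
  ... | inj₁ i<k  = ∣m⇒∣m*n (p k) (p∣primorial i<k)
  ... | inj₂ refl = n∣m*n (primorial k)

module PrimeEnumeration (p : ℕ → ℕ) (pr : ∀ i → Prime (p i))
                        (mono : ∀ i j → i ℕ.< j → p i ℕ.< p j)
                        (surj : ∀ q → Prime q → ∃ λ i → p i ≡ q) where
  open import Data.Nat as ℕ using (ℕ; zero; suc; NonZero)
  import Data.Nat.Properties as ℕ
  open import Data.Nat.Divisibility using (_∣_; ∣⇒≤; ∣-trans)
  open import Data.Rational hiding (NonZero)
  open import Data.Rational.Properties
  open import Data.Product using (∃; _,_)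
  open import Relation.Binary.PropositionalEquality
  open import Relation.Binary.Definitions using (tri<; tri≈; tri>)
  open import Data.Empty using (⊥-elim)
  open Naturals
  open Rationals
  open EulerProduct p pr

  p-reflects-< : ∀ {i k} → p i ℕ.< p k → i ℕ.< k
  p-reflects-< {i} {k} pi<pk with ℕ.<-cmp i k
  ... | tri< i<k _ _ = i<k
  ... | tri≈ _ refl _ = ⊥-elim (ℕ.<-irrefl refl pi<pk)
  ... | tri> _ _ k<i = ⊥-elim (ℕ.<-asym pi<pk (mono k i k<i))

  prime<p⇒∣primorial : ∀ {q k} → Prime q → q ℕ.< p k → q ∣ primorial k
  prime<p⇒∣primorial q-prime q<pk with surj _ q-prime
  ... | i , refl = p∣primorial (p-reflects-< q<pk)

  <p⇒∣primorial^ : ∀ {k} m .{{_ : NonZero m}} → m ℕ.< p k → m ∣ primorial k ℕ.^ m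
  <p⇒∣primorial^ m m<pk =
    ∣^-self m λ q-prime q∣m → prime<p⇒∣primorial q-prime (ℕ.≤-<-trans (∣⇒≤ q∣m) m<pk)

  smoothH≡H : ∀ E k x → x ℕ.< p k → x ℕ.≤ E → SmoothHarmonic.smoothH E k x ≡ H x
  smoothH≡H E k zero    _      _     = refl
  smoothH≡H E k (suc x) 1+x<pk 1+x≤E = cong₂ _+_
    (smoothH≡H E k x (ℕ.<-trans (ℕ.n<1+n x) 1+x<pk) (ℕ.<⇒≤ 1+x≤E))
    (SmoothHarmonic.smoothRecip-∣ E (suc x)
      (∣-trans (<p⇒∣primorial^ (suc x) 1+x<pk) (^-monoʳ-∣ (primorial k) 1+x≤E)))

  density*H≤1 : ∀ k {x} → x ℕ.< p k → density k * H x ≤ 1ℚ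
  density*H≤1 k {x} x<pk = subst (λ h → density k * h ≤ 1ℚ) (smoothH≡H x k x x<pk ℕ.≤-refl)
                             (SmoothHarmonic.density*smoothH≤1 x k x)

  k<p : ∀ k → k ℕ.< p k
  k<p zero    = ℕ.<-trans ℕ.z<s (1<p 0)
  k<p (suc k) = ℕ.≤-<-trans (k<p k) (mono k (suc k) (ℕ.n<1+n k))

  density*B≤1-eventually : ∀ B → ∃ λ N → ∀ n → N ℕ.≤ n → density n * fromℕ B ≤ 1ℚ
  density*B≤1-eventually B = N , λ n N≤n → begin
    density n * fromℕ B    ≤⟨ *-monoʳ-≤-nonNeg (fromℕ B) {{nonNegative (fromℕ-nonNeg B)}}
                                (density-antitone N≤n) ⟩
    density N * fromℕ B    ≤⟨ 0≤r⇒*-monoˡ-≤ (density-nonNeg N) (H-unbounded B) ⟩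
    density N * H N        ≤⟨ density*H≤1 N (k<p N) ⟩
    1ℚ                     ∎
    where
    open ≤-Reasoning
    N = 2 ℕ.^ (B ℕ.* 3)

  density→0 : ∀ ε → 0ℚ < ε → ∃ λ N → ∀ n → N ℕ.≤ n → density n < ε
  density→0 ε 0<ε =
    let (B , 1<εB)  = archimedean ε 0<ε
        (N , small) = density*B≤1-eventually B
    in N , λ n N≤n →
         *-cancelʳ-<-nonNeg (fromℕ B) {{nonNegative (fromℕ-nonNeg B)}} {density n} {ε}
           (≤-<-trans {density n * fromℕ B} {1ℚ} {ε * fromℕ B} (small n N≤n) 1<εB)

open import Defs
open import Data.Nat using (_<_; _≤_)
open import Data.Product using (_,_)
open import Relation.Binary.PropositionalEquality using (subst; sym)
open import Data.Rational using (ℚ; 0ℚ; 1ℚ; _-_; ∣_∣) renaming (_<_ to _<ℚ_)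

theorem1 : (p : ℕ → ℕ) → (pr : ∀ i → Prime (p i))
    → (∀ i j → i < j → p i < p j)
    → (∀ q → Prime q → ∃ λ i → p i ≡ q)
    → ∀ (ε : ℚ) → 0ℚ <ℚ ε
    → ∃ λ (N : ℕ) → ∀ (n : ℕ) → N ≤ n → ∣ S p pr n - 1ℚ ∣ <ℚ ε
theorem1 p pr mono surj ε 0<ε =
  let (N , density<ε) = PrimeEnumeration.density→0 p pr mono surj ε 0<ε
  in N , λ n N≤n → subst (_<ℚ ε) (sym (EulerProduct.∣S-1∣≡density p pr n)) (density<ε n N≤n)
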